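{- For every prime $p\ge 5$ and every integer $s\ge 0$, $$\sum_{\substack{x=1\\ p\nmid x}}^{p^s-1}\frac{(-1)^x}{x^2}\equiv 0 \pmod{p^s},$$ where the sum runs over integers $1\le x\le p^s-1$ not divisible by $p$.
   Context: The congruence is understood in the ring of rational numbers whose denominators are prime to $p$. -}

module Defs where

open import Data.Nat as ℕ using (ℕ; zero; suc; _^_)
open import Data.Nat.Divisibility using (_∣_; _∤_)
open import Data.Nat.Primality using (Prime)
open import Data.Nat.Coprimality using (Coprime)
open import Data.Integer as ℤ using (ℤ; +_; -[1+_])
open import Data.Rational as ℚ using (ℚ; ↧ₙ_)
open import Data.Product using (∃; _×_)
open import Relation.Binary.PropositionalEquality using (_≡_)
open import Relation.Nullary using (Dec; yes; no)
open import Data.Nat.Divisibility using (_∣?_)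

sgn : ℕ → ℤ
sgn zero = + 1
sgn (suc zero) = -[1+ 0 ]
sgn (suc (suc n)) = sgn n

-- the summand (-1)^x / x^2 for x = suc k ≥ 1
term : ℕ → ℚ
term k = ℚ._/_ (sgn (suc k)) (suc k ℕ.* suc k)

S : ℕ → ℕ → ℚ
S p zero = ℚ.0ℚ
S p (suc k) with p ∣? suc k
... | yes _ = S p k
... | no  _ = S p k ℚ.+ term k

-- r lies in the ring Z_(p) of rationals whose denominator is prime to p
-- (denominator of the reduced form)
pIntegral : ℕ → ℚ → Set
pIntegral p r = Coprime (↧ₙ r) p

-- a ≡ b (mod m) in Z_(p): a - b = m * r with r ∈ Z_(p)
CongModIn : ℕ → ℚ → ℚ → ℕ → Set
CongModIn p a b m = ∃ λ r → pIntegral p r × (a ℚ.- b ≡ ℚ._/_ (+ m) 1 ℚ.* r)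

-- Pair each x with y = p^s − x. As p^s is odd, (−1)^y = −(−1)^x, and
--   (−1)^x / x² + (−1)^y / y² = (x + y) · (−1)^x (y − x) / (x² y²),
-- a multiple of x + y = p^s with a p-integral cofactor whenever p ∤ x, y; moreover
-- p ∣ x iff p ∣ y since p ∣ x + y. Summing over all x counts every pair twice, and
-- 1/2 is p-integral because p is odd.
module Submission where

open import Defs
open import Data.Nat using (ℕ; _≤_; _∸_; _^_)
open import Data.Nat.Primality using (Prime)
open import Data.Rational using (0ℚ)

open import Data.Nat as ℕ using (zero; suc; _<_; NonZero; NonTrivial)
import Data.Nat.Properties as ℕ
open import Data.Nat.Divisibility using (_∣_; _∤_; _∣?_; divides; ∣-trans; ∣-refl; ∣m∣n⇒∣m+n; ∣m+n∣m⇒∣n; m∣m*n)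
open import Data.Nat.Primality using (prime⇒irreducible)
open import Data.Nat.Coprimality as Coprime using (Coprime; coprime-divisor; 1-coprimeTo; prime⇒coprime)
open import Data.Integer as ℤ using (ℤ; +_; -[1+_])
import Data.Integer.Properties as ℤ
open import Data.Integer.Solver using (module +-*-Solver)
open import Data.Rational as ℚ using (ℚ; ↧_; ↧ₙ_; _+_; _*_; _/_; ½; fromℚᵘ)
import Data.Rational.Properties as ℚ
open import Data.Rational.Unnormalised as ℚᵘ using (ℚᵘ; *≡*)
import Data.Rational.Unnormalised.Properties as ℚᵘ
open import Algebra.Bundles using (CommutativeMonoid)
open import Algebra.Properties.CommutativeSemigroup
  (CommutativeMonoid.commutativeSemigroup ℚ.+-0-commutativeMonoid) using (interchange)
open import Data.Product using (_,_)
open import Data.Sum using (inj₁; inj₂)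
open import Relation.Nullary using (yes; no; contradiction)
open import Relation.Binary.PropositionalEquality
open ≡-Reasoning

private
  variable
    a b d k m n p : ℕ
    q r : ℚ

coprime-∣ : d ∣ m → Coprime m n → Coprime d n
coprime-∣ d∣m c (i∣d , i∣n) = c (∣-trans i∣d d∣m , i∣n)

coprime-* : Coprime m n → Coprime k n → Coprime (m ℕ.* k) n
coprime-* c₁ c₂ (i∣mk , i∣n) =
  c₂ (coprime-divisor (coprime-∣ i∣n (Coprime.sym c₁)) i∣mk , i∣n)

coprime-^ : Coprime m n → ∀ s → Coprime (m ^ s) n
coprime-^ c zero    = 1-coprimeTo _
coprime-^ c (suc s) = coprime-* c (coprime-^ c s)

coprime⇒∤ : .{{NonTrivial n}} → Coprime m n → n ∤ m
coprime⇒∤ c n∣m = ℕ.nonTrivial⇒≢1 (c (n∣m , ∣-refl))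

∤⇒coprime : Prime p → p ∤ n → Coprime n p
∤⇒coprime pp p∤n (i∣n , i∣p) with prime⇒irreducible pp i∣p
... | inj₁ i≡1 = i≡1
... | inj₂ refl = contradiction i∣n p∤n

sgn-suc : ∀ n → sgn (suc n) ≡ ℤ.- sgn n
sgn-suc zero          = refl
sgn-suc (suc zero)    = refl
sgn-suc (suc (suc n)) = sgn-suc n

sgn-odd : 2 ∤ n → sgn n ≡ -[1+ 0 ]
sgn-odd {zero}        2∤0 = contradiction (divides 0 refl) 2∤0
sgn-odd {suc zero}    _   = refl
sgn-odd {suc (suc n)} 2∤n = sgn-odd (λ 2∣n → 2∤n (∣m∣n⇒∣m+n ∣-refl 2∣n))

sgn-complement : ∀ m n → 2 ∤ m ℕ.+ n → sgn n ≡ ℤ.- sgn m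
sgn-complement zero    n 2∤n   = sgn-odd 2∤n
sgn-complement (suc m) n 2∤m+n = begin
  sgn n                 ≡⟨ ℤ.neg-injective (trans (sym (sgn-suc n)) IH) ⟩
  sgn m                 ≡⟨ ℤ.neg-involutive (sgn m) ⟨
  ℤ.- (ℤ.- sgn m)       ≡⟨ cong ℤ.-_ (sgn-suc m) ⟨
  ℤ.- sgn (suc m)       ∎
  where
  IH : sgn (suc n) ≡ ℤ.- sgn m
  IH = sgn-complement m (suc n) (subst (2 ∤_) (sym (ℕ.+-suc m n)) 2∤m+n)

fromℚᵘ-homo-+ : ∀ x y → fromℚᵘ (x ℚᵘ.+ y) ≡ fromℚᵘ x + fromℚᵘ y
fromℚᵘ-homo-+ x y = ℚ.toℚᵘ-injective (ℚᵘ.≃-trans (ℚ.toℚᵘ-fromℚᵘ (x ℚᵘ.+ y))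
  (ℚᵘ.≃-trans (ℚᵘ.+-cong (ℚᵘ.≃-sym (ℚ.toℚᵘ-fromℚᵘ x)) (ℚᵘ.≃-sym (ℚ.toℚᵘ-fromℚᵘ y)))
    (ℚᵘ.≃-sym (ℚ.toℚᵘ-homo-+ (fromℚᵘ x) (fromℚᵘ y)))))

fromℚᵘ-homo-* : ∀ x y → fromℚᵘ (x ℚᵘ.* y) ≡ fromℚᵘ x * fromℚᵘ y
fromℚᵘ-homo-* x y = ℚ.toℚᵘ-injective (ℚᵘ.≃-trans (ℚ.toℚᵘ-fromℚᵘ (x ℚᵘ.* y))
  (ℚᵘ.≃-trans (ℚᵘ.*-cong (ℚᵘ.≃-sym (ℚ.toℚᵘ-fromℚᵘ x)) (ℚᵘ.≃-sym (ℚ.toℚᵘ-fromℚᵘ y)))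
    (ℚᵘ.≃-sym (ℚ.toℚᵘ-homo-* (fromℚᵘ x) (fromℚᵘ y)))))

-- The integer solver applies because, on successors, + (x ℕ.* y) and + x ℤ.* + y coincide
-- definitionally.
difference-of-inverse-squares : ∀ σ a b → let x = suc a; y = suc b in
  σ / (x ℕ.* x) + (ℤ.- σ) / (y ℕ.* y)
    ≡ (+ (x ℕ.+ y) / 1) * ((σ ℤ.* (+ y ℤ.- + x)) / ((x ℕ.* x) ℕ.* (y ℕ.* y)))
difference-of-inverse-squares σ a b = begin
  fromℚᵘ u + fromℚᵘ v      ≡⟨ fromℚᵘ-homo-+ u v ⟨
  fromℚᵘ (u ℚᵘ.+ v)        ≡⟨ ℚ.fromℚᵘ-cong {u ℚᵘ.+ v} {w ℚᵘ.* z} (*≡* cross-multiplied) ⟩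
  fromℚᵘ (w ℚᵘ.* z)        ≡⟨ fromℚᵘ-homo-* w z ⟩
  fromℚᵘ w * fromℚᵘ z      ∎
  where
  open +-*-Solver
  x y : ℕ
  x = suc a
  y = suc b

  u v w z : ℚᵘ
  u = σ ℚᵘ./ (x ℕ.* x)
  v = (ℤ.- σ) ℚᵘ./ (y ℕ.* y)
  w = + (x ℕ.+ y) ℚᵘ./ 1
  z = (σ ℤ.* (+ y ℤ.- + x)) ℚᵘ./ ((x ℕ.* x) ℕ.* (y ℕ.* y))

  cross-multiplied : ℚᵘ.↥ (u ℚᵘ.+ v) ℤ.* ℚᵘ.↧ (w ℚᵘ.* z) ≡ ℚᵘ.↥ (w ℚᵘ.* z) ℤ.* ℚᵘ.↧ (u ℚᵘ.+ v)
  cross-multiplied = solve 3 (λ σ x y →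
      (σ :* (y :* y) :+ :- σ :* (x :* x)) :* (con (+ 1) :* ((x :* x) :* (y :* y)))
    := ((x :+ y) :* (σ :* (y :- x))) :* ((x :* x) :* (y :* y))) refl σ (+ x) (+ y)

↧ₙ-∣ : ∀ r {i} n → ↧ r ℤ.* i ≡ + n → ↧ₙ r ∣ n
↧ₙ-∣ r {i} n eq = divides ℤ.∣ i ∣ (begin
  n                        ≡⟨ cong ℤ.∣_∣ eq ⟨
  ℤ.∣ ↧ r ℤ.* i ∣          ≡⟨ ℤ.abs-* (↧ r) i ⟩
  ↧ₙ r ℕ.* ℤ.∣ i ∣         ≡⟨ ℕ.*-comm (↧ₙ r) _ ⟩
  ℤ.∣ i ∣ ℕ.* ↧ₙ r         ∎)

pIntegral-0 : pIntegral p 0ℚ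
pIntegral-0 = 1-coprimeTo _

pIntegral-/ : ∀ i n .{{_ : NonZero n}} → Coprime n p → pIntegral p (i / n)
pIntegral-/ i n = coprime-∣ (↧ₙ-∣ (i / n) n (ℚ.↧-/ i n))

pIntegral-+ : pIntegral p q → pIntegral p r → pIntegral p (q + r)
pIntegral-+ {q = q} {r} cq cr = coprime-∣ (↧ₙ-∣ (q + r) (↧ₙ q ℕ.* ↧ₙ r) (ℚ.↧-+ q r)) (coprime-* cq cr)

pIntegral-* : pIntegral p q → pIntegral p r → pIntegral p (q * r)
pIntegral-* {q = q} {r} cq cr = coprime-∣ (↧ₙ-∣ (q * r) (↧ₙ q ℕ.* ↧ₙ r) (ℚ.↧-* q r)) (coprime-* cq cr)

record MultipleIn (p m : ℕ) (q : ℚ) : Set where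
  constructor multiple
  field
    cofactor          : ℚ
    cofactor-integral : pIntegral p cofactor
    ≡m*cofactor       : q ≡ (+ m / 1) * cofactor

multiple-0 : MultipleIn p m 0ℚ
multiple-0 {m = m} = multiple 0ℚ pIntegral-0 (sym (ℚ.*-zeroʳ (+ m / 1)))

multiple-+ : MultipleIn p m q → MultipleIn p m r → MultipleIn p m (q + r)
multiple-+ {m = m} (multiple q′ cq′ q≡) (multiple r′ cr′ r≡) =
  multiple (q′ + r′) (pIntegral-+ {q = q′} {r′} cq′ cr′) (trans (cong₂ _+_ q≡ r≡) (sym (ℚ.*-distribˡ-+ (+ m / 1) q′ r′)))

multiple-* : pIntegral p q → MultipleIn p m r → MultipleIn p m (q * r)
multiple-* {q = q} {m = m} {r} cq (multiple r′ cr′ r≡) =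
  multiple (q * r′) (pIntegral-* {q = q} {r′} cq cr′) (begin
  q * r                    ≡⟨ cong (q *_) r≡ ⟩
  q * (M * r′)             ≡⟨ ℚ.*-assoc q M r′ ⟨
  (q * M) * r′             ≡⟨ cong (_* r′) (ℚ.*-comm q M) ⟩
  (M * q) * r′             ≡⟨ ℚ.*-assoc M q r′ ⟩
  M * (q * r′)             ∎)
  where
  M : ℚ
  M = + m / 1

∑ : ℕ → (ℕ → ℚ) → ℚ
∑ zero    f = 0ℚ
∑ (suc n) f = ∑ n f + f n

∑-distrib-+ : ∀ n (f g : ℕ → ℚ) → ∑ n (λ k → f k + g k) ≡ ∑ n f + ∑ n g
∑-distrib-+ zero    f g = refl
∑-distrib-+ (suc n) f g =
  trans (cong (_+ (f n + g n)) (∑-distrib-+ n f g)) (interchange (∑ n f) (∑ n g) (f n) (g n))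

∑-suc : ∀ n (f : ℕ → ℚ) → ∑ (suc n) f ≡ f 0 + ∑ n (λ k → f (suc k))
∑-suc zero    f = trans (ℚ.+-identityˡ (f 0)) (sym (ℚ.+-identityʳ (f 0)))
∑-suc (suc n) f = trans (cong (_+ f (suc n)) (∑-suc n f)) (ℚ.+-assoc (f 0) _ (f (suc n)))

∑-reverse : ∀ n (f : ℕ → ℚ) → ∑ n f ≡ ∑ n (λ k → f (n ∸ suc k))
∑-reverse zero    f = refl
∑-reverse (suc n) f = begin
  ∑ n f + f n                                ≡⟨ cong (_+ f n) (∑-reverse n f) ⟩
  ∑ n (λ k → f (n ∸ suc k)) + f n            ≡⟨ ℚ.+-comm _ (f n) ⟩
  f n + ∑ n (λ k → f (n ∸ suc k))            ≡⟨ ∑-suc n (λ k → f (n ∸ k)) ⟨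
  ∑ (suc n) (λ k → f (suc n ∸ suc k))        ∎

multiple-∑ : ∀ n {f} → (∀ k → k < n → MultipleIn p m (f k)) → MultipleIn p m (∑ n f)
multiple-∑ zero    _    = multiple-0
multiple-∑ (suc n) mult =
  multiple-+ (multiple-∑ n (λ k k<n → mult k (ℕ.m<n⇒m<1+n k<n))) (mult n ℕ.≤-refl)

½*[q+q]≡q : ∀ q → ½ * (q + q) ≡ q
½*[q+q]≡q q = begin
  ½ * (q + q)              ≡⟨ ℚ.*-distribˡ-+ ½ q q ⟩
  ½ * q + ½ * q            ≡⟨ ℚ.*-distribʳ-+ q ½ ½ ⟨
  (½ + ½) * q              ≡⟨ ℚ.*-identityˡ q ⟩
  q                        ∎

summand : ℕ → ℕ → ℚ
summand p k with p ∣? suc k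
... | yes _ = 0ℚ
... | no  _ = term k

S≡∑summand : ∀ p n → S p n ≡ ∑ n (summand p)
S≡∑summand p zero = refl
S≡∑summand p (suc k) with p ∣? suc k
... | yes _ = trans (S≡∑summand p k) (sym (ℚ.+-identityʳ _))
... | no  _ = cong (_+ term k) (S≡∑summand p k)

summand-pair : Prime p → p ∣ m → 2 ∤ m → suc a ℕ.+ suc b ≡ m →
               MultipleIn p m (summand p a + summand p b)
summand-pair {p} {a = a} {b} pp p∣x+y 2∤x+y refl with p ∣? suc a | p ∣? suc b
... | yes _   | yes _   = multiple-0
... | yes p∣x | no  p∤y = contradiction (∣m+n∣m⇒∣n p∣x+y p∣x) p∤y
... | no  p∤x | yes p∣y =
  contradiction (∣m+n∣m⇒∣n (subst (p ∣_) (ℕ.+-comm (suc a) (suc b)) p∣x+y) p∣y) p∤x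
... | no  p∤x | no  p∤y = multiple c (pIntegral-/ (σ ℤ.* (+ y ℤ.- + x)) _ x²y²⊥p) (begin
  term a + term b                        ≡⟨ cong (λ τ → term a + τ / (y ℕ.* y))
                                                 (sgn-complement x y 2∤x+y) ⟩
  σ / (x ℕ.* x) + (ℤ.- σ) / (y ℕ.* y)    ≡⟨ difference-of-inverse-squares σ a b ⟩
  (+ (x ℕ.+ y) / 1) * c                  ∎)
  where
  x y : ℕ
  x = suc a
  y = suc b

  σ : ℤ
  σ = sgn x

  c : ℚ
  c = (σ ℤ.* (+ y ℤ.- + x)) / ((x ℕ.* x) ℕ.* (y ℕ.* y))

  x⊥p : Coprime x p
  x⊥p = ∤⇒coprime pp p∤x

  y⊥p : Coprime y p
  y⊥p = ∤⇒coprime pp p∤y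

  x²y²⊥p : Coprime ((x ℕ.* x) ℕ.* (y ℕ.* y)) p
  x²y²⊥p = coprime-* (coprime-* x⊥p x⊥p) (coprime-* y⊥p y⊥p)

partner-sum : k < m ∸ 1 → suc k ℕ.+ suc (m ∸ 1 ∸ suc k) ≡ m
partner-sum {k} {suc m} k<m = trans (ℕ.+-suc (suc k) (m ∸ suc k)) (cong suc (ℕ.m+[n∸m]≡n k<m))

S-multiple : Prime p → Coprime 2 p → p ∣ m → 2 ∤ m → MultipleIn p m (S p (m ∸ 1))
S-multiple {p} {m} pp 2⊥p p∣m 2∤m =
  subst (MultipleIn p m) (sym S≡½∑pairs) (multiple-* {q = ½} ½-integral (multiple-∑ N pair))
  where
  N : ℕ
  N = m ∸ 1

  f : ℕ → ℚ
  f = summand p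

  ½-integral : pIntegral p ½
  ½-integral = 2⊥p  -- ↧ₙ ½ reduces to 2

  pair : ∀ k → k < N → MultipleIn p m (f k + f (N ∸ suc k))
  pair k k<N = summand-pair pp p∣m 2∤m (partner-sum k<N)

  S≡½∑pairs : S p N ≡ ½ * ∑ N (λ k → f k + f (N ∸ suc k))
  S≡½∑pairs = begin
    S p N                                     ≡⟨ S≡∑summand p N ⟩
    ∑ N f                                     ≡⟨ ½*[q+q]≡q (∑ N f) ⟨
    ½ * (∑ N f + ∑ N f)                       ≡⟨ cong (λ t → ½ * (∑ N f + t)) (∑-reverse N f) ⟩
    ½ * (∑ N f + ∑ N (λ k → f (N ∸ suc k)))   ≡⟨ cong (½ *_) (∑-distrib-+ N f _) ⟨
    ½ * ∑ N (λ k → f k + f (N ∸ suc k))       ∎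

multiple⇒congruent-0 : MultipleIn p m q → CongModIn p q 0ℚ m
multiple⇒congruent-0 (multiple r r-integral q≡) = r , r-integral , trans (ℚ.+-identityʳ _) q≡

S[p^s∸1]-multiple : Prime p → 2 < p → ∀ s → MultipleIn p (p ^ s) (S p (p ^ s ∸ 1))
S[p^s∸1]-multiple pp 2<p zero    = multiple-0
S[p^s∸1]-multiple {p} pp 2<p (suc s) =
  S-multiple pp (Coprime.sym p⊥2) (m∣m*n (p ^ s)) (coprime⇒∤ (coprime-^ p⊥2 (suc s)))
  where
  p⊥2 : Coprime p 2
  p⊥2 = prime⇒coprime pp 2<p

lemma2p2 : (p s : ℕ) → Prime p → 5 ≤ p →
    CongModIn p (S p (p ^ s ∸ 1)) 0ℚ (p ^ s)
lemma2p2 p s pp 5≤p = multiple⇒congruent-0 (S[p^s∸1]-multiple pp (ℕ.≤-trans (ℕ.m≤m+n 3 2) 5≤p) s)
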